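{- Let $D$ be a forcibly unicyclic or a forcibly bicyclic graphic sequence, and let $G$ be any realization of $D$. Then any two pendant vertices $u$ and $v$ of $G$ satisfy $\mathrm{dist}(u,v)\le 3$.
   Context: All graphs are simple. A realization of a sequence $D=(d_1,\ldots,d_n)$ is a simple graph with vertices $v_1,\ldots,v_n$ with $\deg(v_i)=d_i$; $D$ is graphic if it has a realization. A graphic sequence is forcibly unicyclic (resp. forcibly bicyclic) if every realization of it is connected and has exactly $n$ (resp. $n+1$) edges, where $n$ is the number of vertices. A pendant vertex is a vertex of degree $1$; $\mathrm{dist}(u,v)$ is the length of a shortest $u$–$v$ path. -}

module Defs where

open import Data.Nat using (ℕ; zero; suc; _≤_; _<ᵇ_)
open import Data.Fin using (Fin; toℕ)
open import Data.Bool using (Bool; true; false; if_then_else_; _∧_)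
open import Data.List using (List; map; allFin)
open import Data.Nat.ListAction using (sum)
open import Data.Product using (Σ; ∃; _×_; _,_)
open import Relation.Binary.PropositionalEquality using (_≡_)

record Graph (n : ℕ) : Set where
  field
    adj    : Fin n → Fin n → Bool
    sym    : ∀ i j → adj i j ≡ adj j i
    irrefl : ∀ i → adj i i ≡ false
open Graph public

deg : ∀ {n} → Graph n → Fin n → ℕ
deg {n} G i = sum (map (λ j → if adj G i j then 1 else 0) (allFin n))

edgeCount : ∀ {n} → Graph n → ℕ
edgeCount {n} G =
  sum (map (λ i → sum (map (λ j → if (adj G i j ∧ (toℕ i <ᵇ toℕ j)) then 1 else 0)
                            (allFin n)))
           (allFin n))

data Walk {n : ℕ} (G : Graph n) : Fin n → Fin n → ℕ → Set where
  nil  : ∀ {u} → Walk G u u 0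
  cons : ∀ {u w v k} → adj G u w ≡ true → Walk G w v k → Walk G u v (suc k)

Connected : ∀ {n} → Graph n → Set
Connected G = ∀ u v → ∃ λ k → Walk G u v k

-- dist(u,v) ≤ k  (a shortest u–v walk has length ≤ k iff some walk has length ≤ k)
DistLe : ∀ {n} → Graph n → Fin n → Fin n → ℕ → Set
DistLe G u v k = ∃ λ m → m ≤ k × Walk G u v m

DegSeq : ℕ → Set
DegSeq n = Fin n → ℕ

Realization : ∀ {n} → DegSeq n → Graph n → Set
Realization D G = ∀ i → deg G i ≡ D i

Graphic : ∀ {n} → DegSeq n → Set
Graphic {n} D = Σ (Graph n) λ G → Realization D G

ForciblyUnicyclic : ∀ {n} → DegSeq n → Set
ForciblyUnicyclic {n} D =
  Graphic D × (∀ (G : Graph n) → Realization D G → Connected G × edgeCount G ≡ n)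

ForciblyBicyclic : ∀ {n} → DegSeq n → Set
ForciblyBicyclic {n} D =
  Graphic D × (∀ (G : Graph n) → Realization D G → Connected G × edgeCount G ≡ suc n)

Pendant : ∀ {n} → Graph n → Fin n → Set
Pendant G u = deg G u ≡ 1

-- Let u, v be pendant vertices with neighbours u′, v′.  Unless u = v, u ~ v, u′ = v′ or
-- u′ ~ v′ (giving distance 0, 1, 2 or 3), the 2-switch replacing the edges uu′, vv′ by
-- uv, u′v′ is defined and preserves all degrees (it permutes every row of the adjacency
-- matrix by a transposition), but makes uv a connected component.
-- So some realization of the sequence is disconnected, which a forcibly unicyclic or
-- bicyclic sequence does not allow.
module Submission where

open import Defs hiding (sym)
open import Data.Nat.Properties using (suc-injective; +-0-commutativeMonoid)
open import Algebra.Properties.CommutativeMonoid.Sum +-0-commutativeMonoid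
  using (sum-cong-≗; sum-permute) renaming (sum to ∑)
open import Data.Bool using (Bool; true; false; if_then_else_; _∧_; _∨_)
open import Data.Bool.Properties using (∧-comm; ∨-comm; ∨-identityʳ)
open import Data.Empty using (⊥-elim)
open import Data.Fin using (Fin; zero; suc; _≟_)
open import Data.Fin.Permutation as Perm using (Permutation; _⟨$⟩ʳ_)
open import Data.Fin.Permutation.Components using (transpose)
open import Data.List using (tabulate)
open import Data.List.Properties using (map-tabulate)
open import Data.Nat using (ℕ; zero; suc; _+_; z≤n; s≤s)
open import Data.Nat.ListAction using (sum)
open import Data.Product using (∃; ∃-syntax; _×_; _,_; proj₁; proj₂)
open import Data.Sum using (_⊎_; inj₁; inj₂)
open import Function using (_∘_; id)
open import Relation.Binary.PropositionalEquality
open import Relation.Nullary using (¬_; Dec; yes; no; does)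
open import Relation.Nullary.Decidable using (dec-true; dec-false)

private
  variable
    n : ℕ

indicator : Bool → ℕ
indicator b = if b then 1 else 0

sum-tabulate : (f : Fin n → ℕ) → sum (tabulate f) ≡ ∑ f
sum-tabulate {zero}  f = refl
sum-tabulate {suc n} f = cong (f zero +_) (sum-tabulate (f ∘ suc))

deg≡∑ : (G : Graph n) (i : Fin n) → deg G i ≡ ∑ (indicator ∘ adj G i)
deg≡∑ G i = trans (cong sum (map-tabulate id (indicator ∘ adj G i)))
                  (sum-tabulate (indicator ∘ adj G i))

∑-indicator≡0 : (f : Fin n → Bool) → ∑ (indicator ∘ f) ≡ 0 → ∀ j → f j ≡ false
∑-indicator≡0 f ∑≡0 zero with f zero
... | false = refl
∑-indicator≡0 f ∑≡0 (suc j) with f zero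
... | false = ∑-indicator≡0 (f ∘ suc) ∑≡0 j

∑-indicator≡1 : (f : Fin n → Bool) → ∑ (indicator ∘ f) ≡ 1 →
  ∃[ w ] f w ≡ true × (∀ j → f j ≡ true → j ≡ w)
∑-indicator≡1 {suc n} f ∑≡1 with f zero in f0
... | true = zero , f0 , unique
  where
  unique : ∀ j → f j ≡ true → j ≡ zero
  unique zero    _   = refl
  unique (suc j) fj≡true
    with () ← trans (sym fj≡true) (∑-indicator≡0 (f ∘ suc) (suc-injective ∑≡1) j)
... | false with ∑-indicator≡1 (f ∘ suc) ∑≡1
...   | w , fw , unique = suc w , fw , unique′
  where
  unique′ : ∀ j → f j ≡ true → j ≡ suc w
  unique′ zero    f0≡true with () ← trans (sym f0≡true) f0
  unique′ (suc j) fj≡true = cong suc (unique j fj≡true)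

deg-row-permute : (G H : Graph n) (x : Fin n) (π : Permutation n n) →
  (∀ j → adj H x j ≡ adj G x (π ⟨$⟩ʳ j)) → deg H x ≡ deg G x
deg-row-permute G H x π row = begin
  deg H x                                   ≡⟨ deg≡∑ H x ⟩
  ∑ (indicator ∘ adj H x)                   ≡⟨ sum-cong-≗ (cong indicator ∘ row) ⟩
  ∑ (λ j → indicator (adj G x (π ⟨$⟩ʳ j)))  ≡⟨ sum-permute (indicator ∘ adj G x) π ⟨
  ∑ (indicator ∘ adj G x)                   ≡⟨ deg≡∑ G x ⟨
  deg G x                                   ∎
  where open ≡-Reasoning

transpose-≡ˡ : (p q j : Fin n) → transpose p q j ≡ p → j ≡ q
transpose-≡ˡ p q j eq with j ≟ p
... | yes refl = sym eq
... | no j≢p with j ≟ q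
...   | yes j≡q = j≡q
...   | no  _   = ⊥-elim (j≢p eq)

SoleNeighbour : Graph n → Fin n → Fin n → Set
SoleNeighbour G u u′ = adj G u u′ ≡ true × (∀ w → adj G u w ≡ true → w ≡ u′)

pendant-sole-neighbour : (G : Graph n) {u : Fin n} → Pendant G u → ∃ (SoleNeighbour G u)
pendant-sole-neighbour G {u} pu = ∑-indicator≡1 (adj G u) (trans (sym (deg≡∑ G u)) pu)

adjacent⇒≢ : (G : Graph n) {x y : Fin n} → adj G x y ≡ true → x ≢ y
adjacent⇒≢ G {x} xy refl with () ← trans (sym xy) (irrefl G x)

adjacent-nonadjacent⇒≢ : (G : Graph n) {x y z : Fin n} →
  adj G x y ≡ true → adj G x z ≡ false → y ≢ z
adjacent-nonadjacent⇒≢ G xy xz refl with () ← trans (sym xy) xz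

walk-preserves : (G : Graph n) (P : Fin n → Set) →
  (∀ {x y} → P x → adj G x y ≡ true → P y) →
  ∀ {x y k} → Walk G x y k → P x → P y
walk-preserves G P step nil         px = px
walk-preserves G P step (cons xw w) px = walk-preserves G P step w (step px xw)

_≡ᵇ_ : Fin n → Fin n → Bool
i ≡ᵇ j = does (i ≟ j)

pairᵇ : Fin n → Fin n → Fin n → Fin n → Bool
pairᵇ p q i j = (i ≡ᵇ p ∧ j ≡ᵇ q) ∨ (i ≡ᵇ q ∧ j ≡ᵇ p)

pairᵇ-comm : (p q i j : Fin n) → pairᵇ p q i j ≡ pairᵇ q p i j
pairᵇ-comm p q i j = ∨-comm (i ≡ᵇ p ∧ j ≡ᵇ q) (i ≡ᵇ q ∧ j ≡ᵇ p)

pairᵇ-sym : (p q i j : Fin n) → pairᵇ p q i j ≡ pairᵇ p q j i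
pairᵇ-sym p q i j = trans (pairᵇ-comm p q i j)
  (cong₂ _∨_ (∧-comm (i ≡ᵇ q) (j ≡ᵇ p)) (∧-comm (i ≡ᵇ p) (j ≡ᵇ q)))

pairᵇ-irrefl : {p q : Fin n} → p ≢ q → ∀ i → pairᵇ p q i i ≡ false
pairᵇ-irrefl {p = p} {q} p≢q i with i ≟ p | i ≟ q
... | yes refl | yes refl = ⊥-elim (p≢q refl)
... | yes _    | no  _    = refl
... | no  _    | yes _    = refl
... | no  _    | no  _    = refl

pairᵇ-away : {p q i : Fin n} → i ≢ p → i ≢ q → ∀ j → pairᵇ p q i j ≡ false
pairᵇ-away {p = p} {q} {i} i≢p i≢q j
  rewrite dec-false (i ≟ p) i≢p | dec-false (i ≟ q) i≢q = refl

pairᵇ-from : {p q : Fin n} → p ≢ q → ∀ j → pairᵇ p q p j ≡ j ≡ᵇ q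
pairᵇ-from {p = p} {q} p≢q j
  rewrite dec-true (p ≟ p) refl | dec-false (p ≟ q) p≢q = ∨-identityʳ (j ≡ᵇ q)

switchᵇ : Graph n → (a b c d : Fin n) → Fin n → Fin n → Bool
switchᵇ G a b c d i j =
  if pairᵇ a b i j ∨ pairᵇ c d i j then false
  else if pairᵇ a c i j ∨ pairᵇ b d i j then true
  else adj G i j

switchᵇ-swap-ends : (G : Graph n) (a b c d i j : Fin n) →
  switchᵇ G a b c d i j ≡ switchᵇ G b a d c i j
switchᵇ-swap-ends G a b c d i j
  rewrite pairᵇ-comm b a i j | pairᵇ-comm d c i j
        | ∨-comm (pairᵇ b d i j) (pairᵇ a c i j) = refl

switchᵇ-swap-edges : (G : Graph n) (a b c d i j : Fin n) →
  switchᵇ G a b c d i j ≡ switchᵇ G c d a b i j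
switchᵇ-swap-edges G a b c d i j
  rewrite ∨-comm (pairᵇ c d i j) (pairᵇ a b i j)
        | pairᵇ-comm c a i j | pairᵇ-comm d b i j = refl

switchᵇ-row : (G : Graph n) {a b c d : Fin n} →
  adj G a b ≡ true → adj G a c ≡ false → a ≢ c → a ≢ d →
  ∀ j → switchᵇ G a b c d a j ≡ adj G a (transpose b c j)
switchᵇ-row G {a} {b} {c} {d} ab ac a≢c a≢d j
  rewrite pairᵇ-from (adjacent⇒≢ G ab) j | pairᵇ-away a≢c a≢d j
        | pairᵇ-from a≢c j | pairᵇ-away (adjacent⇒≢ G ab) a≢d j
        | ∨-identityʳ (j ≡ᵇ b) | ∨-identityʳ (j ≡ᵇ c)
  with j ≟ b
... | yes refl = sym ac
... | no  _ with j ≟ c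
...   | yes refl = sym ab
...   | no  _    = refl

switchᵇ-away : (G : Graph n) {a b c d x : Fin n} →
  x ≢ a → x ≢ b → x ≢ c → x ≢ d → ∀ j → switchᵇ G a b c d x j ≡ adj G x j
switchᵇ-away G x≢a x≢b x≢c x≢d j
  rewrite pairᵇ-away x≢a x≢b j | pairᵇ-away x≢c x≢d j
        | pairᵇ-away x≢a x≢c j | pairᵇ-away x≢b x≢d j = refl

module TwoSwitch (G : Graph n) {a b c d : Fin n}
  (ab : adj G a b ≡ true) (cd : adj G c d ≡ true)
  (ac : adj G a c ≡ false) (bd : adj G b d ≡ false)
  (a≢c : a ≢ c) (b≢d : b ≢ d) where

  ba : adj G b a ≡ true
  ba = trans (Graph.sym G b a) ab

  dc : adj G d c ≡ true
  dc = trans (Graph.sym G d c) cd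

  ca : adj G c a ≡ false
  ca = trans (Graph.sym G c a) ac

  db : adj G d b ≡ false
  db = trans (Graph.sym G d b) bd

  b≢c : b ≢ c
  b≢c = adjacent-nonadjacent⇒≢ G ab ac

  d≢a : d ≢ a
  d≢a = adjacent-nonadjacent⇒≢ G cd ca

  switched : Graph n
  switched = record
    { adj    = switchᵇ G a b c d
    ; sym    = symmetric
    ; irrefl = irreflexive
    }
    where
    symmetric : ∀ i j → switchᵇ G a b c d i j ≡ switchᵇ G a b c d j i
    symmetric i j
      rewrite pairᵇ-sym a b i j | pairᵇ-sym c d i j
            | pairᵇ-sym a c i j | pairᵇ-sym b d i j | Graph.sym G i j = refl

    irreflexive : ∀ i → switchᵇ G a b c d i i ≡ false
    irreflexive i rewrite pairᵇ-irrefl a≢c i | pairᵇ-irrefl b≢d i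
      with pairᵇ a b i i ∨ pairᵇ c d i i
    ... | true  = refl
    ... | false = irrefl G i

  row-a : ∀ j → adj switched a j ≡ adj G a (transpose b c j)
  row-a = switchᵇ-row G ab ac a≢c (d≢a ∘ sym)

  -- The configuration is invariant under (a b)(c d) and (a c)(b d), so every row reduces to row-a.
  row-b : ∀ j → adj switched b j ≡ adj G b (transpose a d j)
  row-b j = trans (switchᵇ-swap-ends G a b c d b j) (switchᵇ-row G ba bd b≢d b≢c j)

  row-c : ∀ j → adj switched c j ≡ adj G c (transpose d a j)
  row-c j = trans (switchᵇ-swap-edges G a b c d c j)
                  (switchᵇ-row G cd ca (a≢c ∘ sym) (b≢c ∘ sym) j)

  row-d : ∀ j → adj switched d j ≡ adj G d (transpose c b j)
  row-d j = trans (switchᵇ-swap-edges G a b c d d j)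
            (trans (switchᵇ-swap-ends G c d a b d j) (switchᵇ-row G dc db (b≢d ∘ sym) d≢a j))

  row-permuted : ∀ x → ∃[ π ] ∀ j → adj switched x j ≡ adj G x (π ⟨$⟩ʳ j)
  row-permuted x = by-cases x (x ≟ a) (x ≟ b) (x ≟ c) (x ≟ d)
    where
    by-cases : ∀ y → Dec (y ≡ a) → Dec (y ≡ b) → Dec (y ≡ c) → Dec (y ≡ d) →
      ∃[ π ] ∀ j → adj switched y j ≡ adj G y (π ⟨$⟩ʳ j)
    by-cases y (yes refl) _          _          _          = Perm.transpose b c , row-a
    by-cases y (no _)     (yes refl) _          _          = Perm.transpose a d , row-b
    by-cases y (no _)     (no _)     (yes refl) _          = Perm.transpose d a , row-c
    by-cases y (no _)     (no _)     (no _)     (yes refl) = Perm.transpose c b , row-d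
    by-cases y (no y≢a)   (no y≢b)   (no y≢c)   (no y≢d)   =
      Perm.id , switchᵇ-away G y≢a y≢b y≢c y≢d

  degree-preserved : ∀ x → deg switched x ≡ deg G x
  degree-preserved x with π , row ← row-permuted x = deg-row-permute G switched x π row

  module _ (a-sole : SoleNeighbour G a b) (c-sole : SoleNeighbour G c d) where

    switched-sole-a : ∀ j → adj switched a j ≡ true → j ≡ c
    switched-sole-a j aj = transpose-≡ˡ b c j (proj₂ a-sole _ (trans (sym (row-a j)) aj))

    switched-sole-c : ∀ j → adj switched c j ≡ true → j ≡ a
    switched-sole-c j cj = transpose-≡ˡ d a j (proj₂ c-sole _ (trans (sym (row-c j)) cj))

    ac-component : ∀ {x y} → x ≡ a ⊎ x ≡ c → adj switched x y ≡ true → y ≡ a ⊎ y ≡ c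
    ac-component (inj₁ refl) xy = inj₂ (switched-sole-a _ xy)
    ac-component (inj₂ refl) xy = inj₁ (switched-sole-c _ xy)

    disconnected : ¬ Connected switched
    disconnected conn with walk-preserves switched _ ac-component (proj₂ (conn a b)) (inj₁ refl)
    ... | inj₁ b≡a = adjacent⇒≢ G ab (sym b≡a)
    ... | inj₂ b≡c = b≢c b≡c

pendants-within-3 : (D : DegSeq n) → (∀ H → Realization D H → Connected H) →
  (G : Graph n) → Realization D G →
  (u v : Fin n) → Pendant G u → Pendant G v → DistLe G u v 3
pendants-within-3 D conn G R u v pu pv
  with u′ , u-sole ← pendant-sole-neighbour G pu
     | v′ , v-sole ← pendant-sole-neighbour G pv
     | u ≟ v
... | yes refl = 0 , z≤n , nil
... | no u≢v with adj G u v in uv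
...   | true  = 1 , s≤s z≤n , cons uv nil
...   | false with u′ ≟ v′
...     | yes refl = 2 , s≤s (s≤s z≤n) ,
                   cons (proj₁ u-sole) (cons (trans (Graph.sym G u′ v) (proj₁ v-sole)) nil)
...     | no u′≢v′ with adj G u′ v′ in u′v′
...       | true  = 3 , s≤s (s≤s (s≤s z≤n)) ,
                    cons (proj₁ u-sole)
                      (cons u′v′ (cons (trans (Graph.sym G v′ v) (proj₁ v-sole)) nil))
...       | false = ⊥-elim (disconnected u-sole v-sole (conn switched realization))
  where
  open TwoSwitch G (proj₁ u-sole) (proj₁ v-sole) uv u′v′ u≢v u′≢v′
  realization : Realization D switched
  realization i = trans (degree-preserved i) (R i)

corollary2p1 : (n : ℕ) (D : DegSeq n) →
    ForciblyUnicyclic D ⊎ ForciblyBicyclic D →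
    (G : Graph n) → Realization D G →
    (u v : Fin n) → Pendant G u → Pendant G v → DistLe G u v 3
corollary2p1 n D (inj₁ (_ , forced)) = pendants-within-3 D (λ H R → proj₁ (forced H R))
corollary2p1 n D (inj₂ (_ , forced)) = pendants-within-3 D (λ H R → proj₁ (forced H R))
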